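{- Let $\mathcal{F}$ and $\mathcal{G}$ be filters on $\omega$, with $\mathcal{G}$ selective, and let $\vec{E}=\langle E_n:n\in\omega\rangle$ be an $\mathcal{F}^*$-partition. Define $h:dom(\vec{E})\to\omega$ by $h(k)=n$ iff $k\in E_n$. Assume $h(\mathcal{F})$ and $\mathcal{G}$ are not nearly coherent. Then Player I has no winning strategy in the game $\mathscr{G}_{\vec{E}}(\mathcal{F},\mathcal{G})$.
   Context: $\mathcal{F}^*=\{\omega\setminus X:X\in\mathcal{F}\}$ is the dual ideal. For an ideal $\mathscr{I}$, an $\mathscr{I}$-partition is a family of pairwise disjoint non-empty sets in $\mathscr{I}$ whose union has complement in $\mathscr{I}$, enumerated $\langle E_n\rangle$ with $\min E_n<\min E_{n+1}$; $dom(\vec{E})=\bigcup_n E_n$. For a function $h$, $h(\mathcal{F})=\{X:h^{ -1}[X]\in\mathcal{F}\}$. Filters $\mathcal{A},\mathcal{B}$ on $\omega$ are nearly coherent if there is a finite-to-one $f:\omega\to\omega$ with $f(\mathcal{A})\cup f(\mathcal{B})$ generating a filter. A filter is selective if it is a $p$-filter (every countable subfamily has a pseudointersection in it) and a $q$-filter (every partition of $\omega$ into finite sets has a partial selector in it). The game $\mathscr{G}_{\vec{E}}(\mathcal{F},\mathcal{G})$: in round $n$, Player I plays a natural number $m^0_n>m^0_{n-1}$; Player II answers $m^1_n>m^0_n$; Player I plays $A_n\in\mathcal{G}$; Player II answers $k_n\in A_n$. Player II wins iff $\bigcup_{n\in\omega}\bigcup_{j\in[m^0_n,m^1_n)}E_j\in\mathcal{F}$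 and $\{k_n:n\in\omega\}\in\mathcal{G}$. -}

module Defs where

open import Level using (0ℓ)
open import Data.Nat using (ℕ; zero; suc; _<_; _≤_)
open import Data.Product using (Σ; ∃; _×_; _,_)
open import Data.List using (List; []; _∷_)
open import Data.List.Relation.Unary.All using (All)
open import Data.Sum using (_⊎_)
open import Data.Empty using (⊥)
open import Relation.Nullary using (¬_)
open import Relation.Unary using (Pred; _∈_; _⊆_; _∩_; ∅; ∁)
open import Relation.Binary.PropositionalEquality using (_≡_; _≢_)

Subset : Set₁
Subset = Pred ℕ 0ℓ

Family : Set₁
Family = Pred Subset 0ℓ

Finite : Subset → Set
Finite X = Σ ℕ λ N → ∀ k → k ∈ X → k < N

Cofinite : Subset → Set
Cofinite X = Finite (∁ X)

record Filter : Set₁ where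
  field
    mem      : Family
    upward   : ∀ {X Y} → mem X → X ⊆ Y → mem Y
    inter    : ∀ {X Y} → mem X → mem Y → mem (X ∩ Y)
    proper   : ¬ mem ∅
    frechet  : ∀ X → Cofinite X → mem X
open Filter public

Dual : Filter → Family
Dual F Y = mem F (∁ Y)

_⊆*_ : Subset → Subset → Set
Y ⊆* X = Finite (λ k → k ∈ Y × ¬ (k ∈ X))

IsPFilter : Filter → Set₁
IsPFilter F = (X : ℕ → Subset) → (∀ n → mem F (X n)) →
  Σ Subset λ Y → mem F Y × (∀ n → Y ⊆* X n)

IsFinitePartition : (ℕ → Subset) → Set
IsFinitePartition P =
  (∀ n → Σ ℕ λ k → k ∈ P n) ×
  (∀ n → Finite (P n)) ×
  (∀ n m k → n ≢ m → k ∈ P n → k ∈ P m → ⊥) ×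
  (∀ k → Σ ℕ λ n → k ∈ P n)

IsPartialSelector : (ℕ → Subset) → Subset → Set
IsPartialSelector P Y = ∀ n a b → a ∈ Y → a ∈ P n → b ∈ Y → b ∈ P n → a ≡ b

IsQFilter : Filter → Set₁
IsQFilter F = (P : ℕ → Subset) → IsFinitePartition P →
  Σ Subset λ Y → mem F Y × IsPartialSelector P Y

IsSelective : Filter → Set₁
IsSelective F = IsPFilter F × IsQFilter F

IsMin : Subset → ℕ → Set
IsMin S m = m ∈ S × (∀ k → k ∈ S → m ≤ k)

Dom : (ℕ → Subset) → Subset
Dom E k = Σ ℕ λ n → k ∈ E n

IsIPartition : Family → (ℕ → Subset) → Set
IsIPartition I E =
  (∀ n → Σ ℕ λ k → k ∈ E n) ×
  (∀ n → I (E n)) ×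
  (∀ n m k → n ≢ m → k ∈ E n → k ∈ E m → ⊥) ×
  I (∁ (Dom E)) ×
  (∀ n a b → IsMin (E n) a → IsMin (E (suc n)) b → a < b)

Image : (ℕ → ℕ) → Family → Family
Image f A X = A (λ k → X (f k))

-- h(F) for h : dom(E) → ω, h(k) = n iff k ∈ E_n :
-- h⁻¹[X] = { k : ∃ n ∈ X, k ∈ E_n }
ImageByPartition : (ℕ → Subset) → Family → Family
ImageByPartition E A X = A (λ k → Σ ℕ λ n → k ∈ E n × n ∈ X)

FiniteToOne : (ℕ → ℕ) → Set
FiniteToOne f = ∀ n → Finite (λ k → f k ≡ n)

GeneratesFilter : Family → Set₁
GeneratesFilter S = (L : List Subset) → All S L → Σ ℕ λ n → All (λ X → n ∈ X) L

NearlyCoherent : Family → Family → Set₁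
NearlyCoherent A B = Σ (ℕ → ℕ) λ f → FiniteToOne f ×
  GeneratesFilter (λ X → Image f A X ⊎ Image f B X)

-- History of completed rounds: list of Player II's moves (m¹_i , k_i),
-- most recent first.  Player I's moves are determined by the strategy.
History : Set
History = List (ℕ × ℕ)

record StrategyI : Set₁ where
  field
    firstMove  : History → ℕ
    secondMove : History → ℕ → Subset    -- A_n, given history and m¹_n
open StrategyI public

module Play (σ : StrategyI) (m¹ k : ℕ → ℕ) where
  hist : ℕ → History
  hist zero    = []
  hist (suc n) = (m¹ n , k n) ∷ hist n

  m⁰ : ℕ → ℕ
  m⁰ n = firstMove σ (hist n)

  A : ℕ → Subset
  A n = secondMove σ (hist n) (m¹ n)

  LegalII : ℕ → Set
  LegalII n = m⁰ n < m¹ n × k n ∈ A n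

  LegalIIBelow : ℕ → Set
  LegalIIBelow n = ∀ i → i < n → LegalII i

  IIWins : (ℕ → Subset) → Filter → Filter → Set
  IIWins E F G =
    mem F (λ j → Σ ℕ λ n → Σ ℕ λ i → m⁰ n ≤ i × i < m¹ n × j ∈ E i) ×
    mem G (λ x → Σ ℕ λ n → k n ≡ x)

WinningStrategyI : (ℕ → Subset) → Filter → Filter → StrategyI → Set
WinningStrategyI E F G σ = ∀ (m¹ k : ℕ → ℕ) →
  let open Play σ m¹ k in
  (∀ n → LegalIIBelow n → m⁰ n < m¹ n → mem G (A n)) ×
  (∀ n → LegalIIBelow (suc n) → m⁰ n < m⁰ (suc n)) ×
  ((∀ n → LegalII n) → ¬ IIWins E F G)

{-# OPTIONS --safe #-}
-- Suppose σ is a winning strategy for Player I. As G is a p-filter, one set Z ∈ G is,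
-- beyond a threshold, contained in every legal move A ∈ G that σ can make from one of the
-- finitely many positions with entries below N. Cut ω into blocks [a j, a (j + 1)) where
-- a (j + 1) dominates these thresholds and σ's first moves on positions below a j.
-- Non near coherence of h(F) and G, applied to the finite-to-one maps sending a point of
-- block j to ⌊j / 4⌋ and to ⌊(j + 2) / 4⌋, yields X ∈ h(F) and Y ∈ G whose blocks are never
-- within distance 2; the q-property yields S ∈ G whose points lie at least 3 blocks apart.
-- Player II answers with the increasing enumeration of the G-set Z ∩ Y ∩ S, playing
-- m¹ = a (j - 1) when its next pick lies in block j. These moves are legal, and the intervals
-- [m⁰, m¹) cover every index of X, so ⋃ E_i over them is in F and Player II wins.
module Submission where

open import Defs
open import Level using (0ℓ)
open import Axiom.ExcludedMiddle using (ExcludedMiddle)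
open import Data.Nat
  using (ℕ; zero; suc; pred; _+_; _*_; _⊔_; _/_; _%_; _<_; _≤_; _≤?_; _<?_; _≟_; z≤n; s≤s; s≤s⁻¹; NonZero; >-nonZero)
open import Data.Nat.Properties
open import Data.Nat.DivMod using (m≡m%n+[m/n]*n; m%n<n; m/n*n≤m; m*n/n≡m; m<n*o⇒m/o<n; /-monoˡ-≤)
open import Data.Product using (Σ; _×_; _,_; proj₁; proj₂)
open import Data.Sum as Sum using (_⊎_; inj₁; inj₂; [_,_])
open import Data.Empty using (⊥; ⊥-elim)
open import Data.Unit using (⊤; tt)
open import Data.List using (List; []; _∷_; length; map; concat; upTo; cartesianProduct)
open import Data.List.Membership.Propositional using (_∈_)
open import Data.List.Membership.Propositional.Properties
  using (∈-map⁺; ∈-concat⁺′; ∈-cartesianProduct⁺; ∈-upTo⁺)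
open import Data.List.Relation.Unary.All as All using (All; []; _∷_)
open import Data.List.Relation.Unary.Any using (here; there)
open import Function using (_∘_)
open import Relation.Nullary using (¬_; yes; no; _×-dec_)
open import Relation.Nullary.Decidable using (decidable-stable)
open import Relation.Unary using (Pred; Decidable; ∁; _⟨×⟩_)
open import Relation.Binary.PropositionalEquality using (_≡_; refl; sym; trans; cong; subst)

Listable : {A : Set} → Pred A 0ℓ → Set
Listable {A} P = Σ (List A) λ xs → ∀ a → P a → a ∈ xs

<-listable : ∀ N → Listable (_< N)
<-listable N = upTo N , λ _ → ∈-upTo⁺

⟨×⟩-listable : {A B : Set} {P : Pred A 0ℓ} {Q : Pred B 0ℓ} →
  Listable P → Listable Q → Listable (P ⟨×⟩ Q)
⟨×⟩-listable (xs , xs-complete) (ys , ys-complete) =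
  cartesianProduct xs ys ,
  λ (a , b) (pa , qb) → ∈-cartesianProduct⁺ (xs-complete a pa) (ys-complete b qb)

List≤-listable : {A : Set} {Q : Pred A 0ℓ} → Listable Q → ∀ L →
  Listable (λ xs → length xs ≤ L × All Q xs)
List≤-listable _ zero = [] ∷ [] , λ { [] _ → here refl }
List≤-listable {A} {Q} (ys , ys-complete) (suc L) with List≤-listable (ys , ys-complete) L
... | xss , xss-complete = [] ∷ concat (map extensions ys) , complete
  where
  extensions : A → List (List A)
  extensions y = map (y ∷_) xss
  complete : ∀ xs → length xs ≤ suc L × All Q xs → xs ∈ [] ∷ concat (map extensions ys)
  complete [] _ = here refl
  complete (y ∷ xs) (s≤s len , qy ∷ qxs) =
    there (∈-concat⁺′ (∈-map⁺ (y ∷_) (xss-complete xs (len , qxs)))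
                      (∈-map⁺ extensions (ys-complete y qy)))

listable-bound : {A : Set} {P : Pred A 0ℓ} → Listable P → (g : A → ℕ) →
  Σ ℕ λ M → ∀ a → P a → g a < M
listable-bound (xs , complete) g =
  proj₁ (∈-bound xs) , λ a pa → proj₂ (∈-bound xs) (complete a pa)
  where
  ∈-bound : ∀ xs → Σ ℕ λ M → ∀ {a} → a ∈ xs → g a < M
  ∈-bound [] = 0 , λ ()
  ∈-bound (x ∷ xs) with ∈-bound xs
  ... | M , below = suc (g x) ⊔ M , λ
    { (here refl) → m≤m⊔n (suc (g x)) M
    ; (there a∈xs) → <-≤-trans (below a∈xs) (m≤n⊔m (suc (g x)) M) }

module _ (ℱ : Filter) where

  mem-univ : mem ℱ (λ _ → ⊤)
  mem-univ = frechet ℱ _ (0 , λ _ ¬⊤ → ⊥-elim (¬⊤ tt))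

  mem-≥ : ∀ c → mem ℱ (c ≤_)
  mem-≥ c = frechet ℱ _ (c , λ _ → ≰⇒>)

  mem-All : {A : Set} (T : A → Subset) → (∀ a → mem ℱ (T a)) →
    ∀ xs → mem ℱ (λ x → All (λ a → T a x) xs)
  mem-All T T∈ [] = upward ℱ mem-univ (λ _ → [])
  mem-All T T∈ (a ∷ xs) = upward ℱ (inter ℱ (T∈ a) (mem-All T T∈ xs)) λ (t , ts) → t ∷ ts

  mem-⋂ : {A : Set} {P : Pred A 0ℓ} → Listable P → (T : A → Subset) →
    (∀ a → mem ℱ (T a)) → mem ℱ (λ x → ∀ a → P a → T a x)
  mem-⋂ (xs , complete) T T∈ =
    upward ℱ (mem-All T T∈ xs) λ ts a pa → All.lookup ts (complete a pa)

  module _ (em : ExcludedMiddle 0ℓ) where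

    mem-conditional : ∀ X → mem ℱ (λ x → mem ℱ X → X x)
    mem-conditional X with em {mem ℱ X}
    ... | yes X∈ = upward ℱ X∈ λ x _ → x
    ... | no X∉ = upward ℱ mem-univ λ _ X∈ → ⊥-elim (X∉ X∈)

    mem-unbounded : ∀ {X} → mem ℱ X → ∀ m → Σ ℕ λ y → m ≤ y × X y
    mem-unbounded X∈ m = decidable-stable em λ none →
      proper ℱ (upward ℱ (inter ℱ X∈ (mem-≥ m)) λ (x , m≤y) → none (_ , m≤y , x))

⊆*-beyond : ExcludedMiddle 0ℓ → ∀ {Y X} (Y⊆*X : Y ⊆* X) {x} → Y x → proj₁ Y⊆*X ≤ x → X x
⊆*-beyond em (N , below) {x} y N≤x = decidable-stable em λ ¬x → <⇒≱ (below x (y , ¬x)) N≤x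

InjectiveOn : (ℕ → ℕ) → Subset → Set
InjectiveOn f S = ∀ {x y} → S x → S y → f x ≡ f y → x ≡ y

q-injective : (G : Filter) → IsQFilter G →
  ∀ {f} → FiniteToOne f → (∀ n → Σ ℕ λ k → f k ≡ n) → Σ Subset λ S → mem G S × InjectiveOn f S
q-injective G G-q {f} f-ftf f-onto =
  let (S , S∈G , selects) = G-q (λ n k → f k ≡ n) fibres-partition in
  S , S∈G , λ {x} {y} Sx Sy fx≡fy → selects (f y) x y Sx fx≡fy Sy refl
  where
  fibres-partition : IsFinitePartition (λ n k → f k ≡ n)
  fibres-partition =
    f-onto , f-ftf , (λ n m k n≢m fk≡n fk≡m → n≢m (trans (sym fk≡n) fk≡m)) , λ k → f k , refl

imageFilter : ExcludedMiddle 0ℓ → (F : Filter) (E : ℕ → Subset) → IsIPartition (Dual F) E → Filter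
imageFilter em F E (_ , Eₙᶜ∈F , disjoint , Domᶜᶜ∈F , _) = record
  { mem = ImageByPartition E (mem F)
  ; upward = λ X∈ X⊆Y → upward F X∈ λ (n , k∈Eₙ , Xn) → n , k∈Eₙ , X⊆Y Xn
  ; inter = λ {X} {Y} X∈ Y∈ → upward F (inter F X∈ Y∈)
      λ ((n , k∈Eₙ , Xn) , (n′ , k∈Eₙ′ , Yn′)) →
        n , k∈Eₙ , Xn , subst Y (sym (same-piece k∈Eₙ k∈Eₙ′)) Yn′
  ; proper = λ ∅∈ → proper F (upward F ∅∈ λ ())
  ; frechet = λ X (c , below) →
      upward F (inter F (mem-⋂ F (<-listable c) (∁ ∘ E) Eₙᶜ∈F) Domᶜᶜ∈F)
        λ (outside , ¬¬inside) →
        let (n , k∈Eₙ) = decidable-stable em ¬¬inside in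
        n , k∈Eₙ , decidable-stable em λ ¬Xn → outside n (below n ¬Xn) k∈Eₙ
  }
  where
  same-piece : ∀ {n n′ k} → E n k → E n′ k → n ≡ n′
  same-piece {n} {n′} {k} k∈Eₙ k∈Eₙ′ =
    decidable-stable (n ≟ n′) λ n≢n′ → disjoint n n′ k n≢n′ k∈Eₙ k∈Eₙ′

record Separation (A B : Filter) (f : ℕ → ℕ) : Set₁ where
  field
    U V : Subset
    U∈A : mem A (U ∘ f)
    V∈B : mem B (V ∘ f)
    disjoint : ∀ {y} → U y → V y → ⊥

module _ (em₁ : ExcludedMiddle (Level.suc 0ℓ)) (A B : Filter) {f : ℕ → ℕ} where

  Tagged : Subset → Set
  Tagged X = Image f (mem A) X ⊎ Image f (mem B) X

  split : ∀ Xs → All Tagged Xs →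
    Σ Subset λ U → Σ Subset λ V → mem A (U ∘ f) × mem B (V ∘ f) ×
      (∀ {y} → U y → V y → All (λ X → X y) Xs)
  split [] [] = (λ _ → ⊤) , (λ _ → ⊤) , mem-univ A , mem-univ B , λ _ _ → []
  split (X ∷ Xs) (inj₁ X∈A ∷ tags) with split Xs tags
  ... | U , V , U∈ , V∈ , common =
    (λ y → X y × U y) , V , inter A X∈A U∈ , V∈ , λ (x , u) v → x ∷ common u v
  split (X ∷ Xs) (inj₂ X∈B ∷ tags) with split Xs tags
  ... | U , V , U∈ , V∈ , common =
    U , (λ y → X y × V y) , U∈ , inter B X∈B V∈ , λ u (x , v) → x ∷ common u v

  separate : ¬ NearlyCoherent (mem A) (mem B) → FiniteToOne f → Separation A B f
  separate ¬coh f-ftf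
    with em₁ {Σ (List Subset) λ Xs → All Tagged Xs × ¬ Σ ℕ λ n → All (λ X → X n) Xs}
  ... | no ¬witness =
    ⊥-elim (¬coh (f , f-ftf , λ Xs tags →
      decidable-stable em₁ λ ¬common → ¬witness (Xs , tags , ¬common)))
  ... | yes (Xs , tags , ¬common) with split Xs tags
  ... | U , V , U∈A , V∈B , common = record
    { U = U ; V = V ; U∈A = U∈A ; V∈B = V∈B ; disjoint = λ u v → ¬common (_ , common u v) }

∘-finiteToOne : ∀ {f g} → FiniteToOne f → FiniteToOne g → FiniteToOne (f ∘ g)
∘-finiteToOne {f} {g} f-ftf g-ftf n with f-ftf n
... | N , below-N with listable-bound (<-listable N) (λ v → proj₁ (g-ftf v))
... | M , bound =
  M , λ k fgk≡n → <-trans (proj₂ (g-ftf (g k)) k refl) (bound (g k) (below-N (g k) fgk≡n))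

+-finiteToOne : ∀ e → FiniteToOne (e +_)
+-finiteToOne e n = suc n , λ m e+m≡n → s≤s (subst (m ≤_) e+m≡n (m≤n+m m e))

m<[1+m/n]*n : ∀ m n .{{_ : NonZero n}} → m < suc (m / n) * n
m<[1+m/n]*n m n = begin-strict
  m                 ≡⟨ m≡m%n+[m/n]*n m n ⟩
  m % n + m / n * n <⟨ +-monoˡ-< (m / n * n) (m%n<n m n) ⟩
  n + m / n * n     ∎
  where open ≤-Reasoning

/-finiteToOne : ∀ d .{{_ : NonZero d}} → FiniteToOne (_/ d)
/-finiteToOne d n = suc n * d , λ m m/d≡n → subst (λ q → m < suc q * d) m/d≡n (m<[1+m/n]*n m d)

m/n≡q : ∀ {m n q} .{{_ : NonZero n}} → q * n ≤ m → m < suc q * n → m / n ≡ q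
m/n≡q {m} {n} {q} lo hi =
  ≤-antisym (s≤s⁻¹ (m<n*o⇒m/o<n hi)) (subst (_≤ m / n) (m*n/n≡m q n) (/-monoˡ-≤ n lo))

near-quarters-≤ : ∀ {u v} → u ≤ v → v ≤ 2 + u → u / 4 ≡ v / 4 ⊎ (2 + u) / 4 ≡ (2 + v) / 4
near-quarters-≤ {u} {v} u≤v v≤2+u with v <? suc (u / 4) * 4
... | yes v<next = inj₁ (sym (m/n≡q (≤-trans (m/n*n≤m u 4) u≤v) v<next))
... | no v≮next = inj₂ (trans
    (m/n≡q {n = 4} {q = suc (u / 4)} next≤2+u (≤-<-trans (s≤s (s≤s u≤v)) 2+v<after))
    (sym (m/n≡q {n = 4} {q = suc (u / 4)} (≤-trans next≤v (m≤n+m v 2)) 2+v<after)))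
  where
  next≤v : suc (u / 4) * 4 ≤ v
  next≤v = ≮⇒≥ v≮next
  next≤2+u : suc (u / 4) * 4 ≤ 2 + u
  next≤2+u = ≤-trans next≤v v≤2+u
  2+v<after : 2 + v < suc (suc (u / 4)) * 4
  2+v<after = ≤-<-trans (s≤s (s≤s v≤2+u)) (+-monoʳ-< 4 (m<[1+m/n]*n u 4))

Near : ℕ → ℕ → Set
Near u v = u ≤ 2 + v × v ≤ 2 + u

near-quarters : ∀ {u v} → Near u v → u / 4 ≡ v / 4 ⊎ (2 + u) / 4 ≡ (2 + v) / 4
near-quarters {u} {v} (u≤2+v , v≤2+u) with ≤-total u v
... | inj₁ u≤v = near-quarters-≤ u≤v v≤2+u
... | inj₂ v≤u = Sum.map sym sym (near-quarters-≤ v≤u u≤2+v)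

module Blocks (a : ℕ → ℕ) (a-zero : a 0 ≡ 0) (a-step : ∀ j → a j < a (suc j)) where

  a-mono-< : ∀ {i j} → i < j → a i < a j
  a-mono-< {i} {suc j} i<1+j with m<1+n⇒m<n∨m≡n i<1+j
  ... | inj₁ i<j = <-trans (a-mono-< i<j) (a-step j)
  ... | inj₂ refl = a-step i

  a-mono-≤ : ∀ {i j} → i ≤ j → a i ≤ a j
  a-mono-≤ i≤j with m≤n⇒m<n∨m≡n i≤j
  ... | inj₁ i<j = <⇒≤ (a-mono-< i<j)
  ... | inj₂ refl = ≤-refl

  a-cancel-< : ∀ {i j} → a i < a j → i < j
  a-cancel-< ai<aj = ≰⇒> λ j≤i → <⇒≱ ai<aj (a-mono-≤ j≤i)

  blk : ℕ → ℕ
  blk zero = 0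
  blk (suc x) with a (suc (blk x)) ≤? suc x
  ... | yes _ = suc (blk x)
  ... | no _ = blk x

  blk-spec : ∀ x → a (blk x) ≤ x × x < a (suc (blk x))
  blk-spec zero = ≤-reflexive a-zero , subst (_< a 1) a-zero (a-step 0)
  blk-spec (suc x) with a (suc (blk x)) ≤? suc x | blk-spec x
  ... | yes reached | _ , x<next = reached , ≤-<-trans x<next (a-step (suc (blk x)))
  ... | no ¬reached | a[blk]≤x , _ = m≤n⇒m≤1+n a[blk]≤x , ≰⇒> ¬reached

  blk-lo : ∀ x → a (blk x) ≤ x
  blk-lo x = proj₁ (blk-spec x)

  blk-hi : ∀ x → x < a (suc (blk x))
  blk-hi x = proj₂ (blk-spec x)

  blk-ge : ∀ {j x} → a j ≤ x → j ≤ blk x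
  blk-ge {x = x} aj≤x = s≤s⁻¹ (a-cancel-< (≤-<-trans aj≤x (blk-hi x)))

  blk-mono : ∀ {x y} → x ≤ y → blk x ≤ blk y
  blk-mono {x} x≤y = blk-ge (≤-trans (blk-lo x) x≤y)

  blk-a : ∀ j → blk (a j) ≡ j
  blk-a j = ≤-antisym (s≤s⁻¹ (a-cancel-< (≤-<-trans (blk-lo (a j)) (a-step j)))) (blk-ge ≤-refl)

  blk-finiteToOne : FiniteToOne blk
  blk-finiteToOne j = a (suc j) , λ x blk≡j → subst (λ i → x < a (suc i)) blk≡j (blk-hi x)

Least : Pred ℕ 0ℓ → ℕ → Set
Least P z = P z × (∀ w → w < z → ¬ P w)

minimal : {P : Pred ℕ 0ℓ} → Decidable P → ∀ {y} → P y → Σ ℕ (Least P)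
minimal {P} P? {y} py = search y 0 (λ _ ()) (subst P (sym (+-identityʳ y)) py)
  where
  search : ∀ k n → (∀ w → w < n → ¬ P w) → P (k + n) → Σ ℕ (Least P)
  search zero n none-below pn = n , pn , none-below
  search (suc k) n none-below pk+n with P? n
  ... | yes pn = n , pn , none-below
  ... | no ¬pn = search k (suc n) none-to-n (subst P (sym (+-suc k n)) pk+n)
    where
    none-to-n : ∀ w → w < suc n → ¬ P w
    none-to-n w w<1+n with m<1+n⇒m<n∨m≡n w<1+n
    ... | inj₁ w<n = none-below w w<n
    ... | inj₂ refl = ¬pn

transition : {P : Pred ℕ 0ℓ} → Decidable P → P 0 →
  ∀ {N} → ¬ P N → Σ ℕ λ n → P n × ¬ P (suc n)
transition P? p0 {zero} ¬p0 = ⊥-elim (¬p0 p0)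
transition P? p0 {suc N} ¬pN+1 with P? N
... | yes pN = N , pN , ¬pN+1
... | no ¬pN = transition P? p0 ¬pN

module Enumeration {X : Subset} (X? : Decidable X) (unbounded : ∀ m → Σ ℕ λ y → m ≤ y × X y) where

  least≥ : ∀ m → Σ ℕ (Least λ y → m ≤ y × X y)
  least≥ m = minimal (λ w → (m ≤? w) ×-dec X? w) (proj₂ (unbounded m))

  enum floor : ℕ → ℕ
  enum n = proj₁ (least≥ (floor n))
  floor zero = 0
  floor (suc n) = suc (enum n)

  floor≤enum : ∀ n → floor n ≤ enum n
  floor≤enum n = proj₁ (proj₁ (proj₂ (least≥ (floor n))))

  enum-∈ : ∀ n → X (enum n)
  enum-∈ n = proj₂ (proj₁ (proj₂ (least≥ (floor n))))

  enum-< : ∀ n → enum n < enum (suc n)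
  enum-< n = floor≤enum (suc n)

  n≤enum : ∀ n → n ≤ enum n
  n≤enum zero = z≤n
  n≤enum (suc n) = ≤-<-trans (n≤enum n) (enum-< n)

  enum-least : ∀ n {y} → floor n ≤ y → X y → enum n ≤ y
  enum-least n {y} floor≤y Xy =
    ≮⇒≥ λ y<enum → proj₂ (proj₂ (least≥ (floor n))) y y<enum (floor≤y , Xy)

  enum-onto : ∀ {y} → X y → Σ ℕ λ n → enum n ≡ y
  enum-onto {y} Xy = reached y (n≤enum y)
    where
    reached : ∀ n → y ≤ enum n → Σ ℕ λ i → enum i ≡ y
    reached zero y≤enum = zero , ≤-antisym (enum-least zero z≤n Xy) y≤enum
    reached (suc n) y≤enum with y ≤? enum n
    ... | yes y≤enum-n = reached n y≤enum-n
    ... | no y≰enum-n = suc n , ≤-antisym (enum-least (suc n) (≰⇒> y≰enum-n) Xy) y≤enum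

SmallHistory : ℕ → History → Set
SmallHistory N h = length h ≤ N × All ((_< N) ⟨×⟩ (_< N)) h

SmallPosition : ℕ → History × ℕ → Set
SmallPosition N = SmallHistory N ⟨×⟩ (_< N)

SmallHistory-listable : ∀ N → Listable (SmallHistory N)
SmallHistory-listable N = List≤-listable (⟨×⟩-listable (<-listable N) (<-listable N)) N

SmallPosition-listable : ∀ N → Listable (SmallPosition N)
SmallPosition-listable N = ⟨×⟩-listable (SmallHistory-listable N) (<-listable N)

SmallHistory-mono : ∀ {N N′ h} → N ≤ N′ → SmallHistory N h → SmallHistory N′ h
SmallHistory-mono N≤N′ (len , entries) =
  ≤-trans len N≤N′ ,
  All.map (λ (p<N , q<N) → <-≤-trans p<N N≤N′ , <-≤-trans q<N N≤N′) entries

module Counterplay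
  (em₀ : ExcludedMiddle 0ℓ) (em₁ : ExcludedMiddle (Level.suc 0ℓ))
  (F G : Filter) (G-p : IsPFilter G) (G-q : IsQFilter G)
  (E : ℕ → Subset) (E-part : IsIPartition (Dual F) E)
  (¬coh : ¬ NearlyCoherent (ImageByPartition E (mem F)) (mem G))
  (σ : StrategyI) (σ-wins : WinningStrategyI E F G σ) where

  hF : Filter
  hF = imageFilter em₀ F E E-part

  Answers : History × ℕ → Subset
  Answers (h , m) x = mem G (secondMove σ h m) → secondMove σ h m x

  AnswersAll : ℕ → Subset
  AnswersAll N x = ∀ p → SmallPosition N p → Answers p x

  pseudo : Σ Subset λ Z → mem G Z × (∀ N → Z ⊆* AnswersAll N)
  pseudo = G-p AnswersAll λ N →
    mem-⋂ G (SmallPosition-listable N) Answers λ (h , m) → mem-conditional G em₀ (secondMove σ h m)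

  Z : Subset
  Z = proj₁ pseudo

  Z∈G : mem G Z
  Z∈G = proj₁ (proj₂ pseudo)

  threshold : ℕ → ℕ
  threshold N = proj₁ (proj₂ (proj₂ pseudo) N)

  Z-answers : ∀ N {x} → Z x → threshold N ≤ x → AnswersAll N x
  Z-answers N = ⊆*-beyond em₀ (proj₂ (proj₂ pseudo) N)

  firstMoveBound : ℕ → ℕ
  firstMoveBound N = proj₁ (listable-bound (SmallHistory-listable N) (firstMove σ))

  firstMove<bound : ∀ {N h} → SmallHistory N h → firstMove σ h < firstMoveBound N
  firstMove<bound {N} {h} = proj₂ (listable-bound (SmallHistory-listable N) (firstMove σ)) h

  -- Opaque because unfolding a (suc j) is exponential in j.
  opaque
    a : ℕ → ℕ
    a zero = 0
    a (suc j) = suc (a j + firstMoveBound (a j) + threshold (suc (a j)))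

    a-step : ∀ j → a j < a (suc j)
    a-step j = s≤s (≤-trans (m≤m+n (a j) _) (m≤m+n _ (threshold (suc (a j)))))

    a-firstMove : ∀ j → firstMoveBound (a j) ≤ a (suc j)
    a-firstMove j = m≤n⇒m≤1+n (≤-trans (m≤n+m _ (a j)) (m≤m+n _ (threshold (suc (a j)))))

    a-threshold : ∀ j → threshold (suc (a j)) ≤ a (suc j)
    a-threshold j = m≤n⇒m≤1+n (m≤n+m _ (a j + firstMoveBound (a j)))

    a-zero : a 0 ≡ 0
    a-zero = refl

  open Blocks a a-zero a-step

  quarter₀ quarter₂ : ℕ → ℕ
  quarter₀ = (_/ 4) ∘ blk
  quarter₂ = (_/ 4) ∘ (2 +_) ∘ blk

  near-quarter : ∀ {x y} → Near (blk x) (blk y) →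
    quarter₀ x ≡ quarter₀ y ⊎ quarter₂ x ≡ quarter₂ y
  near-quarter = near-quarters

  quarter₀-finiteToOne : FiniteToOne quarter₀
  quarter₀-finiteToOne = ∘-finiteToOne (/-finiteToOne 4) blk-finiteToOne

  quarter₂-finiteToOne : FiniteToOne quarter₂
  quarter₂-finiteToOne = ∘-finiteToOne (/-finiteToOne 4) (∘-finiteToOne (+-finiteToOne 2) blk-finiteToOne)

  quarter₀-onto : ∀ n → Σ ℕ λ x → quarter₀ x ≡ n
  quarter₀-onto n = a (n * 4) , trans (cong (_/ 4) (blk-a (n * 4))) (m*n/n≡m n 4)

  quarter₂-onto : ∀ n → Σ ℕ λ x → quarter₂ x ≡ n
  quarter₂-onto n = a (n * 4) , trans (cong (λ b → (2 + b) / 4) (blk-a (n * 4)))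
    (m/n≡q {n = 4} (m≤n+m (n * 4) 2) (+-monoˡ-< (n * 4) (s≤s (s≤s (s≤s z≤n)))))

  module Sep₀ = Separation (separate em₁ hF G ¬coh quarter₀-finiteToOne)
  module Sep₂ = Separation (separate em₁ hF G ¬coh quarter₂-finiteToOne)

  X : Subset
  X i = Sep₀.U (quarter₀ i) × Sep₂.U (quarter₂ i)

  Y : Subset
  Y y = Sep₀.V (quarter₀ y) × Sep₂.V (quarter₂ y)

  X∈hF : mem hF X
  X∈hF = inter hF Sep₀.U∈A Sep₂.U∈A

  Y∈G : mem G Y
  Y∈G = inter G Sep₀.V∈B Sep₂.V∈B

  X-far-from-Y : ∀ {i y} → X i → Y y → ¬ Near (blk i) (blk y)
  X-far-from-Y {i} {y} (u₀ , u₂) (v₀ , v₂) near =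
    [ (λ e → Sep₀.disjoint u₀ (subst Sep₀.V (sym e) v₀))
    , (λ e → Sep₂.disjoint u₂ (subst Sep₂.V (sym e) v₂))
    ] (near-quarter {i} {y} near)

  selector₀ : Σ Subset λ S → mem G S × InjectiveOn quarter₀ S
  selector₀ = q-injective G G-q {quarter₀} quarter₀-finiteToOne quarter₀-onto

  selector₂ : Σ Subset λ S → mem G S × InjectiveOn quarter₂ S
  selector₂ = q-injective G G-q {quarter₂} quarter₂-finiteToOne quarter₂-onto

  S : Subset
  S x = proj₁ selector₀ x × proj₁ selector₂ x

  S∈G : mem G S
  S∈G = inter G (proj₁ (proj₂ selector₀)) (proj₁ (proj₂ selector₂))

  S-spread : ∀ {x y} → S x → S y → x < y → 2 + blk x < blk y
  S-spread {x} {y} (s₀x , s₂x) (s₀y , s₂y) x<y = ≰⇒> λ blky≤2+blkx →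
    <-irrefl ([ proj₂ (proj₂ selector₀) s₀x s₀y , proj₂ (proj₂ selector₂) s₂x s₂y ]
                (near-quarter {x} {y} (≤-trans (blk-mono (<⇒≤ x<y)) (m≤n+m _ 2) , blky≤2+blkx))) x<y

  Picks : Subset
  Picks y = Z y × Y y × S y × a 2 ≤ y

  Picks∈G : mem G Picks
  Picks∈G = inter G Z∈G (inter G Y∈G (inter G S∈G (mem-≥ G (a 2))))

  open Enumeration {Picks} (λ _ → em₀) (mem-unbounded G em₀ Picks∈G)
    renaming (enum to pick; enum-∈ to pick-∈; enum-onto to pick-onto)

  pick-Y : ∀ n → Y (pick n)
  pick-Y n = proj₁ (proj₂ (pick-∈ n))

  pick-S : ∀ n → S (pick n)
  pick-S n = proj₁ (proj₂ (proj₂ (pick-∈ n)))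

  block : ℕ → ℕ
  block n = blk (pick n)

  2≤block : ∀ n → 2 ≤ block n
  2≤block n = blk-ge (proj₂ (proj₂ (proj₂ (pick-∈ n))))

  suc-pred-block : ∀ n → suc (pred (block n)) ≡ block n
  suc-pred-block n = suc-pred (block n) {{>-nonZero (≤-trans (s≤s z≤n) (2≤block n))}}

  block-gap : ∀ n → 2 + block n < block (suc n)
  block-gap n = S-spread (pick-S n) (pick-S (suc n)) (enum-< n)

  -- One block below the pick, so that the pick is past the threshold of the position it answers.
  m¹ : ℕ → ℕ
  m¹ n = a (pred (block n))

  open Play σ m¹ pick

  horizon : ℕ → ℕ
  horizon zero = 0
  horizon (suc n) = suc (block n)

  horizon-gap : ∀ n → horizon n < pred (block n)
  horizon-gap zero = pred-mono-≤ (2≤block 0)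
  horizon-gap (suc n) = pred-mono-≤ (block-gap n)

  horizon<block : ∀ n → horizon n < block n
  horizon<block n = <-≤-trans (horizon-gap n) pred[n]≤n

  n<pred-block : ∀ n → n < pred (block n)
  n<pred-block zero = horizon-gap zero
  n<pred-block (suc n) =
    ≤-trans (s≤s (s≤s (<⇒≤ (<-≤-trans (n<pred-block n) pred[n]≤n)))) (horizon-gap (suc n))

  hist-small : ∀ n → SmallHistory (a (horizon n)) (hist n)
  hist-small zero = z≤n , []
  hist-small (suc n) =
    ≤-<-trans (proj₁ (hist-small n)) (a-mono-< horizon<1+block) ,
    (a-mono-< (s≤s pred[n]≤n) , blk-hi (pick n)) ∷
    proj₂ (SmallHistory-mono (a-mono-≤ (<⇒≤ horizon<1+block)) (hist-small n))
    where
    horizon<1+block : horizon n < suc (block n)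
    horizon<1+block = m<n⇒m<1+n (horizon<block n)

  m⁰<a[1+horizon] : ∀ n → m⁰ n < a (suc (horizon n))
  m⁰<a[1+horizon] n = <-≤-trans (firstMove<bound (hist-small n)) (a-firstMove (horizon n))

  m⁰<m¹ : ∀ n → m⁰ n < m¹ n
  m⁰<m¹ n = <-≤-trans (m⁰<a[1+horizon] n) (a-mono-≤ (horizon-gap n))

  pick-∈A : ∀ n → mem G (A n) → A n (pick n)
  pick-∈A n =
    Z-answers (suc (m¹ n)) (proj₁ (pick-∈ n)) late (hist n , m¹ n)
      (SmallHistory-mono (m≤n⇒m≤1+n (a-mono-≤ (<⇒≤ (horizon-gap n)))) (hist-small n) , ≤-refl)
    where
    late : threshold (suc (m¹ n)) ≤ pick n
    late = ≤-trans (a-threshold (pred (block n)))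
             (≤-trans (a-mono-≤ (≤-reflexive (suc-pred-block n))) (blk-lo (pick n)))

  A∈G : ∀ n → LegalIIBelow n → mem G (A n)
  A∈G n below = proj₁ (σ-wins m¹ pick) n below (m⁰<m¹ n)

  legal-step : ∀ n → LegalIIBelow n → LegalII n
  legal-step n below = m⁰<m¹ n , pick-∈A n (A∈G n below)

  legal-below : ∀ n → LegalIIBelow n
  legal-below zero i ()
  legal-below (suc n) i i<1+n =
    [ legal-below n i
    , (λ i≡n → subst LegalII (sym i≡n) (legal-step n (legal-below n)))
    ] (m<1+n⇒m<n∨m≡n i<1+n)

  legal : ∀ n → LegalII n
  legal n = legal-below (suc n) n ≤-refl

  X-beyond-pick : ∀ {i} n → X i → pred (block n) ≤ blk i → 2 + block n ≤ blk i
  X-beyond-pick {i} n Xi entered = decidable-stable (2 + block n ≤? blk i) λ ¬beyond →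
    X-far-from-Y {i} {pick n} Xi (pick-Y n)
      ( <⇒≤ (≰⇒> ¬beyond)
      , ≤-trans (≤-reflexive (sym (suc-pred-block n))) (s≤s (m≤n⇒m≤1+n entered)))

  Entered : ℕ → ℕ → Set
  Entered b n = pred (block n) ≤ b

  last-entered : ∀ b → Entered b 0 → Σ ℕ λ n → Entered b n × ¬ Entered b (suc n)
  last-entered b start =
    transition {Entered b} (λ n → pred (block n) ≤? b) start (<⇒≱ (n<pred-block b))

  covered : ∀ {i} → X i → a (block 0) ≤ i → Σ ℕ λ n → m⁰ n ≤ i × i < m¹ n
  covered {i} Xi start =
    let (n , entered , ¬left) = last-entered (blk i) (≤-trans pred[n]≤n (blk-ge start)) in
    suc n ,
    <⇒≤ (<-≤-trans (m⁰<a[1+horizon] (suc n))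
                   (≤-trans (a-mono-≤ (X-beyond-pick {i} n Xi entered)) (blk-lo i))) ,
    <-≤-trans (blk-hi i) (a-mono-≤ (≰⇒> ¬left))

  F-wins : mem F (λ k → Σ ℕ λ n → Σ ℕ λ i → m⁰ n ≤ i × i < m¹ n × E i k)
  F-wins = upward F (inter hF X∈hF (mem-≥ hF (a (block 0)))) in-some-interval
    where
    in-some-interval : ∀ {k} → (Σ ℕ λ i → E i k × X i × a (block 0) ≤ i) →
      Σ ℕ λ n → Σ ℕ λ i → m⁰ n ≤ i × i < m¹ n × E i k
    in-some-interval (i , k∈Eᵢ , Xi , start) =
      let (n , m⁰≤i , i<m¹) = covered {i} Xi start in n , i , m⁰≤i , i<m¹ , k∈Eᵢ

  G-wins : mem G (λ y → Σ ℕ λ n → pick n ≡ y)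
  G-wins = upward G Picks∈G pick-onto

  absurd : ⊥
  absurd = proj₂ (proj₂ (σ-wins m¹ pick)) legal (F-wins , G-wins)

mainTheorem8 : ExcludedMiddle 0ℓ → ExcludedMiddle (Level.suc 0ℓ) →
    (F G : Filter) → IsSelective G →
    (E : ℕ → Subset) → IsIPartition (Dual F) E →
    ¬ NearlyCoherent (ImageByPartition E (mem F)) (mem G) →
    ¬ (Σ StrategyI λ σ → WinningStrategyI E F G σ)
mainTheorem8 em₀ em₁ F G (G-p , G-q) E E-part ¬coh (σ , σ-wins) =
  Counterplay.absurd em₀ em₁ F G G-p G-q E E-part ¬coh σ σ-wins
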